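{- Let $d\ge 4$. Given any fixed color $c_t$ ($t\in\mathbb{F}_q^*$), the distance graph $G^{\Delta}_q$ in $\mathbb{F}_q^d$ has diameter at most $3$ with respect to the color $c_t$.
   Context: $\mathbb{F}_q$ is the finite field with $q$ elements, $q$ a power of an odd prime, and $\|x\|=x_1^2+\dots+x_d^2$. $G^{\Delta}_q$ has vertex set $\mathbb{F}_q^d$ and, for each $t\in\mathbb{F}_q^*$, vertices $x,y$ are joined by an edge of color $c_t$ if $\|x-y\|=t$. With respect to a fixed color $c$: a path of length $k$ from $x$ to $y$ is a sequence of distinct vertices $x^1=x,\dots,x^{k+1}=y$ with $x^i$ and $x^{i+1}$ joined by a $c$-colored edge for each $1\le i\le k$; a path is optimal if its length is as small as possible; the diameter with respect to $c$ is the largest length of an optimal path between any two vertices. -}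

module Defs where

open import Level using (Level; _⊔_) renaming (suc to lsuc)
open import Algebra.Bundles using (CommutativeRing)
open import Data.Nat using (ℕ; zero; suc)
open import Data.Fin using (Fin; zero; suc; inject₁; fromℕ)
open import Data.Product using (Σ; ∃; _×_)
open import Relation.Nullary using (¬_; Dec)
open import Relation.Binary.PropositionalEquality using (_≡_; _≢_)

-- A finite field: a commutative ring with 1 ≉ 0, inverses of nonzero
-- elements, decidable equality, and a finite enumeration (bijection with
-- Fin q up to the setoid equality).  q is then automatically a prime power.
record FiniteField (c ℓ : Level) : Set (lsuc (c ⊔ ℓ)) where
  field
    commRing : CommutativeRing c ℓ
  open CommutativeRing commRing public hiding (ring)
  field
    1≉0     : ¬ (1# ≈ 0#)
    inverse : ∀ x → ¬ (x ≈ 0#) → ∃ λ y → x * y ≈ 1#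
    _≟_     : ∀ x y → Dec (x ≈ y)
    size    : ℕ
    enum    : Fin size → Carrier
    enum-injective  : ∀ i j → enum i ≈ enum j → i ≡ j
    enum-surjective : ∀ x → ∃ λ i → enum i ≈ x

module _ {c ℓ : Level} (F : FiniteField c ℓ) where
  open FiniteField F using (Carrier; _≈_; _+_; _*_; _-_; 0#; 1#)

  OddChar : Set ℓ
  OddChar = ¬ (1# + 1# ≈ 0#)

  Point : ℕ → Set c
  Point d = Fin d → Carrier

  _≈ᵖ_ : ∀ {d} → Point d → Point d → Set ℓ
  x ≈ᵖ y = ∀ i → x i ≈ y i

  norm : ∀ {d} → Point d → Carrier
  norm {zero}  x = 0#
  norm {suc d} x = x zero * x zero + norm {d} (λ i → x (suc i))

  _-ᵖ_ : ∀ {d} → Point d → Point d → Point d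
  (x -ᵖ y) i = x i - y i

  Edge : ∀ {d} → Carrier → Point d → Point d → Set ℓ
  Edge t x y = norm (x -ᵖ y) ≈ t

  record Path {d : ℕ} (t : Carrier) (k : ℕ) (x y : Point d) : Set (c ⊔ ℓ) where
    field
      vertex   : Fin (suc k) → Point d
      start    : vertex zero ≈ᵖ x
      end      : vertex (fromℕ k) ≈ᵖ y
      distinct : ∀ i j → i ≢ j → ¬ (vertex i ≈ᵖ vertex j)
      edges    : ∀ (i : Fin k) → Edge t (vertex (inject₁ i)) (vertex (suc i))

module Submission where

-- Every s in F_q is a sum of two squares: otherwise sending a to a² when a is the chosen
-- representative of {a, - a}, and to s - a² when it is not, would inject F_q into F_q ∖ {s}.
-- Given x and y, solving g₀² + g₁² = t - Σ_{i ≥ 2} (x_i - y_i)² yields a neighbour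
-- w = (y₀ + g₀, y₁ + g₁, x₂, x₃, …) of y that agrees with x outside the first two coordinates.
-- Then v = (x₀ + a₀, x₁ + a₁, x₂ + u₀, x₃ + u₁, x₄, …) with (a₀, a₁) = (w₀ - x₀, w₁ - x₁) / 2
-- and u₀² + u₁² = t - a₀² - a₁² is a common neighbour of x and w; this is where d ≥ 4 and
-- odd q are used.  So x, v, w, y is a path unless x = y or x and y are already adjacent.

open import Defs
open import Level using (Level)
open import Algebra.Bundles using (CommutativeRing)
import Algebra.Properties.AbelianGroup as AbelianGroupProperties
import Algebra.Properties.Ring as RingProperties
open import Data.Empty using (⊥; ⊥-elim)
open import Data.Fin using (Fin; zero; suc; toℕ)
open import Data.Fin.Patterns using (0F; 1F; 2F; 3F)
import Data.Fin.Properties as Fin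
open import Data.Nat using (ℕ; zero; suc; _≤_; z≤n; s≤s)
import Data.Nat.Properties as ℕ
open import Data.Product using (∃; ∃₂; _×_; _,_; proj₁; proj₂)
open import Data.Sum using (_⊎_; inj₁; inj₂)
open import Function using (_∘_; id)
open import Relation.Binary.PropositionalEquality as ≡ using (_≡_; _≢_)
open import Relation.Nullary using (¬_; Dec; yes; no; contradiction)

module FieldProperties {c ℓ : Level} (F : FiniteField c ℓ) where
  open FiniteField F
  open RingProperties (CommutativeRing.ring commRing) using (-‿distribˡ-*; -‿distribʳ-*; [y-z]x≈yx-zx)
  open AbelianGroupProperties +-abelianGroup public
    using (xyx⁻¹≈y; ⁻¹-anti-homo‿-; ⁻¹-involutive; ⁻¹-∙-comm; x∙y⁻¹≈ε⇒x≈y; inverseˡ-unique;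
           //-rightDividesˡ; \\-leftDividesˡ; ⁻¹-injective; ε⁻¹≈ε; identityʳ-unique; x≈y⇒x∙y⁻¹≈ε; ∙-cancelˡ)
  open import Relation.Binary.Reasoning.Setoid setoid

  -x*-x≈x*x : ∀ x → - x * - x ≈ x * x
  -x*-x≈x*x x = begin
    - x * - x      ≈⟨ -‿distribʳ-* (- x) x ⟨
    - (- x * x)    ≈⟨ -‿cong (-‿distribˡ-* x x) ⟨
    - - (x * x)    ≈⟨ ⁻¹-involutive (x * x) ⟩
    x * x          ∎

  x≈-y⇒x*x≈y*y : ∀ {x y} → x ≈ - y → x * x ≈ y * y
  x≈-y⇒x*x≈y*y {x} {y} x≈-y = trans (*-cong x≈-y x≈-y) (-x*-x≈x*x y)

  x-[x+y]≈-y : ∀ x y → x - (x + y) ≈ - y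
  x-[x+y]≈-y x y = begin
    x - (x + y)    ≈⟨ ⁻¹-anti-homo‿- (x + y) x ⟨
    - (x + y - x)  ≈⟨ -‿cong (xyx⁻¹≈y x y) ⟩
    - y            ∎

  x+[y-x]≈y : ∀ x y → x + (y - x) ≈ y
  x+[y-x]≈y x y = trans (+-congˡ (+-comm y (- x))) (\\-leftDividesˡ x y)

  x+y-[x+z]≈y-z : ∀ x y z → x + y - (x + z) ≈ y - z
  x+y-[x+z]≈y-z x y z = begin
    x + y - (x + z)        ≈⟨ +-congˡ (⁻¹-∙-comm x z) ⟨
    x + y + (- x + - z)    ≈⟨ +-assoc x y (- x + - z) ⟩
    x + (y + (- x + - z))  ≈⟨ +-congˡ (+-congˡ (+-comm (- x) (- z))) ⟩
    x + (y + (- z + - x))  ≈⟨ +-congˡ (+-assoc y (- z) (- x)) ⟨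
    x + (y - z + - x)      ≈⟨ +-assoc x (y - z) (- x) ⟨
    x + (y - z) - x        ≈⟨ xyx⁻¹≈y x (y - z) ⟩
    y - z                  ∎

  x*y≈0⇒x≈0⊎y≈0 : ∀ x y → x * y ≈ 0# → x ≈ 0# ⊎ y ≈ 0#
  x*y≈0⇒x≈0⊎y≈0 x y xy≈0 with x ≟ 0#
  ... | yes x≈0 = inj₁ x≈0
  ... | no x≉0 with x⁻¹ , xx⁻¹≈1 ← inverse x x≉0 = inj₂ (begin
    y              ≈⟨ *-identityˡ y ⟨
    1# * y         ≈⟨ *-congʳ (trans (sym xx⁻¹≈1) (*-comm x x⁻¹)) ⟩
    x⁻¹ * x * y    ≈⟨ *-assoc x⁻¹ x y ⟩
    x⁻¹ * (x * y)  ≈⟨ *-congˡ xy≈0 ⟩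
    x⁻¹ * 0#       ≈⟨ zeroʳ x⁻¹ ⟩
    0#             ∎)

  x*x≈0⇒x≈0 : ∀ x → x * x ≈ 0# → x ≈ 0#
  x*x≈0⇒x≈0 x xx≈0 with x*y≈0⇒x≈0⊎y≈0 x x xx≈0
  ... | inj₁ x≈0 = x≈0
  ... | inj₂ x≈0 = x≈0

  x*x≈y*y⇒x≈y⊎x≈-y : ∀ x y → x * x ≈ y * y → x ≈ y ⊎ x ≈ - y
  x*x≈y*y⇒x≈y⊎x≈-y x y xx≈yy with x*y≈0⇒x≈0⊎y≈0 (x - y) (x + y) difference-of-squares
    where
    x[x+y]≈y[x+y] : x * (x + y) ≈ y * (x + y)
    x[x+y]≈y[x+y] = begin
      x * (x + y)    ≈⟨ distribˡ x x y ⟩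
      x * x + x * y  ≈⟨ +-cong xx≈yy (*-comm x y) ⟩
      y * y + y * x  ≈⟨ +-comm (y * y) (y * x) ⟩
      y * x + y * y  ≈⟨ distribˡ y x y ⟨
      y * (x + y)    ∎

    difference-of-squares : (x - y) * (x + y) ≈ 0#
    difference-of-squares = begin
      (x - y) * (x + y)            ≈⟨ [y-z]x≈yx-zx (x + y) x y ⟩
      x * (x + y) - y * (x + y)    ≈⟨ x≈y⇒x∙y⁻¹≈ε x[x+y]≈y[x+y] ⟩
      0#                           ∎
  ... | inj₁ x-y≈0 = inj₁ (x∙y⁻¹≈ε⇒x≈y x y x-y≈0)
  ... | inj₂ x+y≈0 = inj₂ (inverseˡ-unique x y x+y≈0)

  half : OddChar F → ∃ λ h → h + h ≈ 1#
  half 2≉0 with h , 2h≈1 ← inverse (1# + 1#) 2≉0 = h , (begin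
    h + h            ≈⟨ +-cong (*-identityˡ h) (*-identityˡ h) ⟨
    1# * h + 1# * h  ≈⟨ distribʳ h 1# 1# ⟨
    (1# + 1#) * h    ≈⟨ 2h≈1 ⟩
    1#               ∎)

module SumsOfTwoSquares {c ℓ : Level} (F : FiniteField c ℓ) where
  open FiniteField F
  open FieldProperties F

  index : Carrier → Fin size
  index x = proj₁ (enum-surjective x)

  enum-index : ∀ x → enum (index x) ≈ x
  enum-index x = proj₂ (enum-surjective x)

  index-cong : ∀ {x y} → x ≈ y → index x ≡ index y
  index-cong {x} {y} x≈y = enum-injective (index x) (index y)
    (trans (enum-index x) (trans x≈y (sym (enum-index y))))

  index-injective : ∀ {x y} → index x ≡ index y → x ≈ y
  index-injective {x} {y} ix≡iy =
    trans (sym (enum-index x)) (trans (reflexive (≡.cong enum ix≡iy)) (enum-index y))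

  no-injection-from-Fin[1+size] : (f : Fin (suc size) → Carrier) → ¬ (∀ i j → f i ≈ f j → i ≡ j)
  no-injection-from-Fin[1+size] f f-injective
    with i , j , i<j , fi≡fj ← Fin.pigeonhole (ℕ.n<1+n size) (index ∘ f)
    = Fin.<⇒≢ i<j (f-injective i j (index-injective fi≡fj))

  -- a is the member of {a, - a} with the smaller index (both are, when a ≈ - a)
  Canonical : Carrier → Set
  Canonical a = toℕ (index a) ≤ toℕ (index (- a))

  canonical? : ∀ a → Dec (Canonical a)
  canonical? a = toℕ (index a) ℕ.≤? toℕ (index (- a))

  canonical-cong : ∀ {a b} → a ≈ b → Canonical a → Canonical b
  canonical-cong a≈b rewrite index-cong a≈b | index-cong (-‿cong a≈b) = id

  canonical-total : ∀ a → Canonical a ⊎ Canonical (- a)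
  canonical-total a with ℕ.≤-total (toℕ (index a)) (toℕ (index (- a)))
  ... | inj₁ a≤-a = inj₁ a≤-a
  ... | inj₂ -a≤a rewrite index-cong (⁻¹-involutive a) = inj₂ -a≤a

  canonical-antisym : ∀ {a} → Canonical a → Canonical (- a) → a ≈ - a
  canonical-antisym {a} a≤-a -a≤--a rewrite index-cong (⁻¹-involutive a) =
    index-injective (Fin.toℕ-injective (ℕ.≤-antisym a≤-a -a≤--a))

  canonical-0 : Canonical 0#
  canonical-0 with canonical-total 0#
  ... | inj₁ 0-canonical  = 0-canonical
  ... | inj₂ -0-canonical = canonical-cong ε⁻¹≈ε -0-canonical

  module NotASumOfTwoSquares (s : Carrier) (no-representation : ∀ a b → ¬ (a * a + b * b ≈ s)) where

    squareOrComplement : (a : Carrier) → Dec (Canonical a) → Carrier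
    squareOrComplement a (yes _) = a * a
    squareOrComplement a (no _)  = s - a * a

    squareOrComplement≉s : ∀ a a? → ¬ (squareOrComplement a a? ≈ s)
    squareOrComplement≉s a (yes _) aa≈s =
      no-representation a 0# (trans (+-congˡ (zeroˡ 0#)) (trans (+-identityʳ (a * a)) aa≈s))
    squareOrComplement≉s a (no a-noncanonical) s-aa≈s = a-noncanonical (canonical-cong (sym a≈0) canonical-0)
      where
      a≈0 : a ≈ 0#
      a≈0 = x*x≈0⇒x≈0 a (⁻¹-injective (trans (identityʳ-unique s (- (a * a)) s-aa≈s) (sym ε⁻¹≈ε)))

    squareOrComplement-injective : ∀ a b a? b? →
      squareOrComplement a a? ≈ squareOrComplement b b? → a ≈ b
    squareOrComplement-injective a b (yes a-canonical) (yes b-canonical) aa≈bb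
      with x*x≈y*y⇒x≈y⊎x≈-y a b aa≈bb
    ... | inj₁ a≈b  = a≈b
    ... | inj₂ a≈-b = trans a≈-b (sym (canonical-antisym b-canonical (canonical-cong a≈-b a-canonical)))
    squareOrComplement-injective a b (yes _) (no _) aa≈s-bb =
      contradiction (trans (+-congʳ aa≈s-bb) (//-rightDividesˡ (b * b) s)) (no-representation a b)
    squareOrComplement-injective a b (no _) (yes _) s-aa≈bb =
      contradiction (trans (+-congʳ (sym s-aa≈bb)) (//-rightDividesˡ (a * a) s)) (no-representation b a)
    squareOrComplement-injective a b (no a-noncanonical) (no b-noncanonical) s-aa≈s-bb
      with x*x≈y*y⇒x≈y⊎x≈-y a b (⁻¹-injective (∙-cancelˡ s (- (a * a)) (- (b * b)) s-aa≈s-bb))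
    ... | inj₁ a≈b  = a≈b
    ... | inj₂ a≈-b with canonical-total b
    ...   | inj₁ b-canonical  = contradiction b-canonical b-noncanonical
    ...   | inj₂ -b-canonical = contradiction (canonical-cong (sym a≈-b) -b-canonical) a-noncanonical

    s∷squareOrComplement : Fin (suc size) → Carrier
    s∷squareOrComplement zero    = s
    s∷squareOrComplement (suc i) = squareOrComplement (enum i) (canonical? (enum i))

    s∷squareOrComplement-injective : ∀ i j → s∷squareOrComplement i ≈ s∷squareOrComplement j → i ≡ j
    s∷squareOrComplement-injective zero    zero    _     = ≡.refl
    s∷squareOrComplement-injective zero    (suc j) s≈fj  = contradiction (sym s≈fj) (squareOrComplement≉s _ (canonical? _))
    s∷squareOrComplement-injective (suc i) zero    fi≈s  = contradiction fi≈s (squareOrComplement≉s _ (canonical? _))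
    s∷squareOrComplement-injective (suc i) (suc j) fi≈fj = ≡.cong suc (enum-injective i j
      (squareOrComplement-injective _ _ (canonical? (enum i)) (canonical? (enum j)) fi≈fj))

    absurd : ⊥
    absurd = no-injection-from-Fin[1+size] s∷squareOrComplement s∷squareOrComplement-injective

  sumOfTwoSquares : ∀ s → ∃₂ λ a b → a * a + b * b ≈ s
  sumOfTwoSquares s with Fin.any? (λ i → Fin.any? (λ j → (enum i * enum i + enum j * enum j) ≟ s))
  ... | yes (i , j , represents-s) = enum i , enum j , represents-s
  ... | no ¬represented = ⊥-elim (NotASumOfTwoSquares.absurd s no-representation)
    where
    no-representation : ∀ a b → ¬ (a * a + b * b ≈ s)
    no-representation a b aa+bb≈s = ¬represented (index a , index b ,
      trans (+-cong (*-cong (enum-index a) (enum-index a)) (*-cong (enum-index b) (enum-index b))) aa+bb≈s)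

module Geometry {c ℓ : Level} (F : FiniteField c ℓ) where
  open FiniteField F hiding (zero)
  open FieldProperties F
  open SumsOfTwoSquares F using (sumOfTwoSquares)
  open import Relation.Binary.Reasoning.Setoid setoid

  norm-cong : ∀ {d} {x y : Point F d} → (∀ i → x i ≈ y i) → norm F x ≈ norm F y
  norm-cong {zero}  x≈y = refl
  norm-cong {suc d} x≈y = +-cong (*-cong (x≈y zero) (x≈y zero)) (norm-cong (x≈y ∘ suc))

  norm-zero : ∀ {d} {x : Point F d} → (∀ i → x i ≈ 0#) → norm F x ≈ 0#
  norm-zero {zero}      x≈0 = refl
  norm-zero {suc d} {x} x≈0 = begin
    x zero * x zero + norm F (x ∘ suc)  ≈⟨ +-cong (*-congʳ (x≈0 zero)) (norm-zero (x≈0 ∘ suc)) ⟩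
    0# * x zero + 0#                    ≈⟨ +-identityʳ (0# * x zero) ⟩
    0# * x zero                         ≈⟨ zeroˡ (x zero) ⟩
    0#                                  ∎

  Edge-resp : ∀ {d t} {x x′ y y′ : Point F d} →
    _≈ᵖ_ F x x′ → _≈ᵖ_ F y y′ → Edge F t x y → Edge F t x′ y′
  Edge-resp x≈x′ y≈y′ xy = trans (norm-cong (λ i → sym (+-cong (x≈x′ i) (-‿cong (y≈y′ i))))) xy

  Edge-irreflexive : ∀ {d t} {x y : Point F d} → ¬ (t ≈ 0#) → Edge F t x y → ¬ (_≈ᵖ_ F x y)
  Edge-irreflexive t≉0 xy x≈y = t≉0 (trans (sym xy) (norm-zero (λ i → x≈y⇒x∙y⁻¹≈ε (x≈y i))))

  ≈ᵖ-sym : ∀ {d} {x y : Point F d} → _≈ᵖ_ F x y → _≈ᵖ_ F y x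
  ≈ᵖ-sym x≈y i = sym (x≈y i)

  path₀ : ∀ {d t} {x y : Point F d} → _≈ᵖ_ F x y → Path F t 0 x y
  path₀ {x = x} x≈y = record
    { vertex   = λ _ → x
    ; start    = λ _ → refl
    ; end      = x≈y
    ; distinct = λ { zero zero 0≢0 → contradiction ≡.refl 0≢0 }
    ; edges    = λ ()
    }

  path₁ : ∀ {d t} {x y : Point F d} → ¬ (t ≈ 0#) → Edge F t x y → Path F t 1 x y
  path₁ {x = x} {y} t≉0 xy = record
    { vertex   = vertex
    ; start    = λ _ → refl
    ; end      = λ _ → refl
    ; distinct = distinct
    ; edges    = λ { zero → xy }
    }
    where
    vertex : Fin 2 → Point F _
    vertex 0F = x
    vertex 1F = y

    distinct : ∀ i j → i ≢ j → ¬ (_≈ᵖ_ F (vertex i) (vertex j))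
    distinct 0F 0F 0≢0 = contradiction ≡.refl 0≢0
    distinct 0F 1F _   = Edge-irreflexive t≉0 xy
    distinct 1F 0F _   = Edge-irreflexive t≉0 xy ∘ ≈ᵖ-sym
    distinct 1F 1F 1≢1 = contradiction ≡.refl 1≢1

  path₃ : ∀ {d t} {x v w y : Point F d} → ¬ (t ≈ 0#) → ¬ (_≈ᵖ_ F x y) → ¬ Edge F t x y →
    Edge F t x v → Edge F t v w → Edge F t w y → Path F t 3 x y
  path₃ {x = x} {v} {w} {y} t≉0 x≉y ¬xy xv vw wy = record
    { vertex   = vertex
    ; start    = λ _ → refl
    ; end      = λ _ → refl
    ; distinct = distinct
    ; edges    = λ { 0F → xv ; 1F → vw ; 2F → wy }
    }
    where
    vertex : Fin 4 → Point F _
    vertex 0F = x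
    vertex 1F = v
    vertex 2F = w
    vertex 3F = y

    x≉v : ¬ (_≈ᵖ_ F x v)
    x≉v = Edge-irreflexive t≉0 xv
    v≉w : ¬ (_≈ᵖ_ F v w)
    v≉w = Edge-irreflexive t≉0 vw
    w≉y : ¬ (_≈ᵖ_ F w y)
    w≉y = Edge-irreflexive t≉0 wy
    x≉w : ¬ (_≈ᵖ_ F x w)
    x≉w x≈w = ¬xy (Edge-resp (≈ᵖ-sym x≈w) (λ _ → refl) wy)
    v≉y : ¬ (_≈ᵖ_ F v y)
    v≉y v≈y = ¬xy (Edge-resp (λ _ → refl) v≈y xv)

    distinct : ∀ i j → i ≢ j → ¬ (_≈ᵖ_ F (vertex i) (vertex j))
    distinct 0F 0F 0≢0 = contradiction ≡.refl 0≢0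
    distinct 0F 1F _   = x≉v
    distinct 0F 2F _   = x≉w
    distinct 0F 3F _   = x≉y
    distinct 1F 0F _   = x≉v ∘ ≈ᵖ-sym
    distinct 1F 1F 1≢1 = contradiction ≡.refl 1≢1
    distinct 1F 2F _   = v≉w
    distinct 1F 3F _   = v≉y
    distinct 2F 0F _   = x≉w ∘ ≈ᵖ-sym
    distinct 2F 1F _   = v≉w ∘ ≈ᵖ-sym
    distinct 2F 2F 2≢2 = contradiction ≡.refl 2≢2
    distinct 2F 3F _   = w≉y
    distinct 3F 0F _   = x≉y ∘ ≈ᵖ-sym
    distinct 3F 1F _   = v≉y ∘ ≈ᵖ-sym
    distinct 3F 2F _   = w≉y ∘ ≈ᵖ-sym
    distinct 3F 3F 3≢3 = contradiction ≡.refl 3≢3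

  AgreeFrom₂ : ∀ {d} → Point F (suc (suc d)) → Point F (suc (suc d)) → Set ℓ
  AgreeFrom₂ x y = ∀ i → x (suc (suc i)) ≈ y (suc (suc i))

  neighbour-agreeingFrom₂ : ∀ {d} t (x y : Point F (suc (suc d))) →
    ∃ λ w → AgreeFrom₂ x w × Edge F t w y
  neighbour-agreeingFrom₂ t x y = w , (λ _ → refl) , wy
    where
    rest : Carrier
    rest = norm F (λ i → x (suc (suc i)) - y (suc (suc i)))

    g : ∃₂ λ g₀ g₁ → g₀ * g₀ + g₁ * g₁ ≈ t - rest
    g = sumOfTwoSquares (t - rest)

    w : Point F _
    w 0F = y 0F + proj₁ g
    w 1F = y 1F + proj₁ (proj₂ g)
    w (suc (suc i)) = x (suc (suc i))

    wy : Edge F t w y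
    wy with g₀ , g₁ , gg≈t-rest ← g = begin
      (y 0F + g₀ - y 0F) * (y 0F + g₀ - y 0F) + ((y 1F + g₁ - y 1F) * (y 1F + g₁ - y 1F) + rest)
        ≈⟨ +-cong (*-cong (xyx⁻¹≈y _ g₀) (xyx⁻¹≈y _ g₀)) (+-congʳ (*-cong (xyx⁻¹≈y _ g₁) (xyx⁻¹≈y _ g₁))) ⟩
      g₀ * g₀ + (g₁ * g₁ + rest)  ≈⟨ +-assoc (g₀ * g₀) (g₁ * g₁) rest ⟨
      g₀ * g₀ + g₁ * g₁ + rest    ≈⟨ +-congʳ gg≈t-rest ⟩
      t - rest + rest             ≈⟨ //-rightDividesˡ rest t ⟩
      t                           ∎

  common-neighbour : ∀ {d} → OddChar F → ∀ t (x w : Point F (suc (suc (suc (suc d))))) →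
    AgreeFrom₂ x w → ∃ λ v → Edge F t x v × Edge F t v w
  common-neighbour oddChar t x w x≈w = v , xv , vw
    where
    h : Carrier
    h = proj₁ (half oddChar)

    a₀ a₁ : Carrier
    a₀ = h * (w 0F - x 0F)
    a₁ = h * (w 1F - x 1F)

    u : ∃₂ λ u₀ u₁ → u₀ * u₀ + u₁ * u₁ ≈ t - (a₀ * a₀ + a₁ * a₁)
    u = sumOfTwoSquares (t - (a₀ * a₀ + a₁ * a₁))

    u₀ u₁ : Carrier
    u₀ = proj₁ u
    u₁ = proj₁ (proj₂ u)

    v : Point F _
    v 0F = x 0F + a₀
    v 1F = x 1F + a₁
    v 2F = x 2F + u₀
    v 3F = x 3F + u₁
    v (suc (suc (suc (suc i)))) = x (suc (suc (suc (suc i))))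

    four-squares : ∀ {A B C D E} → A ≈ a₀ * a₀ → B ≈ a₁ * a₁ → C ≈ u₀ * u₀ → D ≈ u₁ * u₁ → E ≈ 0# →
      A + (B + (C + (D + E))) ≈ t
    four-squares {A} {B} {C} {D} {E} A≈ B≈ C≈ D≈ E≈ = begin
      A + (B + (C + (D + E)))                            ≈⟨ +-cong A≈ (+-cong B≈ (+-cong C≈ (+-cong D≈ E≈))) ⟩
      a₀ * a₀ + (a₁ * a₁ + (u₀ * u₀ + (u₁ * u₁ + 0#)))  ≈⟨ +-congˡ (+-congˡ (+-congˡ (+-identityʳ (u₁ * u₁)))) ⟩
      a₀ * a₀ + (a₁ * a₁ + (u₀ * u₀ + u₁ * u₁))         ≈⟨ +-assoc (a₀ * a₀) (a₁ * a₁) (u₀ * u₀ + u₁ * u₁) ⟨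
      a₀ * a₀ + a₁ * a₁ + (u₀ * u₀ + u₁ * u₁)           ≈⟨ +-congˡ (proj₂ (proj₂ u)) ⟩
      a₀ * a₀ + a₁ * a₁ + (t - (a₀ * a₀ + a₁ * a₁))     ≈⟨ x+[y-x]≈y (a₀ * a₀ + a₁ * a₁) t ⟩
      t                                                  ∎

    p+h[q-p]-q≈-h[q-p] : ∀ p q → p + h * (q - p) - q ≈ - (h * (q - p))
    p+h[q-p]-q≈-h[q-p] p q = begin
      p + h * (q - p) - q                    ≈⟨ +-congˡ (-‿cong (x+[y-x]≈y p q)) ⟨
      p + h * (q - p) - (p + (q - p))        ≈⟨ x+y-[x+z]≈y-z p (h * (q - p)) (q - p) ⟩
      h * (q - p) - (q - p)                  ≈⟨ +-congˡ (-‿cong q-p≈h[q-p]+h[q-p]) ⟩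
      h * (q - p) - (h * (q - p) + h * (q - p))  ≈⟨ x-[x+y]≈-y (h * (q - p)) (h * (q - p)) ⟩
      - (h * (q - p))                        ∎
      where
      q-p≈h[q-p]+h[q-p] : q - p ≈ h * (q - p) + h * (q - p)
      q-p≈h[q-p]+h[q-p] = begin
        q - p                          ≈⟨ *-identityˡ (q - p) ⟨
        1# * (q - p)                   ≈⟨ *-congʳ (proj₂ (half oddChar)) ⟨
        (h + h) * (q - p)              ≈⟨ distribʳ (q - p) h h ⟩
        h * (q - p) + h * (q - p)      ∎

    xv : Edge F t x v
    xv = four-squares
      (x≈-y⇒x*x≈y*y (x-[x+y]≈-y (x 0F) a₀)) (x≈-y⇒x*x≈y*y (x-[x+y]≈-y (x 1F) a₁))
      (x≈-y⇒x*x≈y*y (x-[x+y]≈-y (x 2F) u₀)) (x≈-y⇒x*x≈y*y (x-[x+y]≈-y (x 3F) u₁))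
      (norm-zero (λ i → -‿inverseʳ (x (suc (suc (suc (suc i)))))))

    x+a-w≈a : ∀ i a → x (suc (suc i)) + a - w (suc (suc i)) ≈ a
    x+a-w≈a i a = trans (+-congˡ (-‿cong (sym (x≈w i)))) (xyx⁻¹≈y (x (suc (suc i))) a)

    vw : Edge F t v w
    vw = four-squares
      (x≈-y⇒x*x≈y*y (p+h[q-p]-q≈-h[q-p] (x 0F) (w 0F))) (x≈-y⇒x*x≈y*y (p+h[q-p]-q≈-h[q-p] (x 1F) (w 1F)))
      (*-cong (x+a-w≈a 0F u₀) (x+a-w≈a 0F u₀)) (*-cong (x+a-w≈a 1F u₁) (x+a-w≈a 1F u₁))
      (norm-zero (λ i → x≈y⇒x∙y⁻¹≈ε (x≈w (suc (suc i)))))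

open Geometry using (path₀; path₁; path₃; neighbour-agreeingFrom₂; common-neighbour)

mainTheorem6 : ∀ {c ℓ} (F : FiniteField c ℓ) → OddChar F →
    (d : ℕ) → 4 ≤ d →
    (t : FiniteField.Carrier F) → ¬ (FiniteField._≈_ F t (FiniteField.0# F)) →
    (x y : Point F d) →
    ∃ λ k → k ≤ 3 × Path F t k x y
mainTheorem6 F oddChar (suc (suc (suc (suc d)))) (s≤s (s≤s (s≤s (s≤s _)))) t t≉0 x y
  with Fin.all? (λ i → FiniteField._≟_ F (x i) (y i)) | FiniteField._≟_ F (norm F (_-ᵖ_ F x y)) t
... | yes x≈y | _      = 0 , z≤n , path₀ F x≈y
... | no _    | yes xy = 1 , s≤s z≤n , path₁ F t≉0 xy
... | no x≉y  | no ¬xy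
  with w , x≈w , wy ← neighbour-agreeingFrom₂ F t x y
  with v , xv , vw ← common-neighbour F oddChar t x w x≈w
  = 3 , s≤s (s≤s (s≤s z≤n)) , path₃ F {v = v} {w} t≉0 x≉y ¬xy xv vw wy
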